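{- Let $k\ge 2$ and $1\le \ell\le k/2$ be integers, and let $n\equiv \ell \pmod{k-\ell}$. Then \[ \hat{R}(\mathcal{P}_{n,\ell}^{(k)}) \le \hat{R}(P_n), \] and consequently $\hat{R}(\mathcal{P}_{n,\ell}^{(k)})=O(n)$.
   Context: $P_n$ is the graph path on $n$ vertices. For $1\le\ell<k$ and $n\equiv\ell\pmod{k-\ell}$, the $\ell$-path $\mathcal{P}_{n,\ell}^{(k)}$ is the $k$-uniform hypergraph with vertex set $[n]$ and edges $e_i=\{(i-1)(k-\ell)+1,\dots,(i-1)(k-\ell)+k\}$ for $i=1,\dots,\frac{n-\ell}{k-\ell}$ (consecutive edges share exactly $\ell$ vertices). For $k$-graphs (graphs when $k=2$), $\mathcal{H}\to\mathcal{G}$ means every 2-coloring of the edges of $\mathcal{H}$ yields a monochromatic copy of $\mathcal{G}$, and $\hat{R}(\mathcal{G})=\min\{|E(\mathcal{H})|:\mathcal{H}\to\mathcal{G}\}$. It is known (Beck) that $\hat{R}(P_n)=O(n)$. -}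

module Defs where

open import Data.Nat using (ℕ; zero; suc; _+_; _*_; _∸_; _≤_; _≤?_; _<?_)
open import Data.Bool using (Bool; _∧_)
open import Data.Fin using (Fin; toℕ; _≟_)
open import Data.Fin.Subset using (Subset; ∣_∣)
open import Data.Fin.Subset.Properties using (_∈?_)
open import Data.Fin.Properties using (any?)
open import Data.Vec using (tabulate)
open import Data.List using (List; length; lookup; map; upTo)
open import Data.List.Relation.Unary.All using (All)
open import Data.List.Relation.Unary.Unique.Propositional using (Unique)
open import Data.Product using (Σ; ∃; _×_; _,_)
open import Relation.Nullary.Decidable using (⌊_⌋; _×-dec_)
open import Relation.Binary.PropositionalEquality using (_≡_)
open import Function.Definitions using (Injective)

record Hypergraph : Set where
  constructor hg
  field
    V : ℕ
    E : List (Subset V)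
open Hypergraph public

-- H is a k-graph (k-uniform hypergraph): every edge has exactly k vertices and
-- edges are pairwise distinct (so |E(H)| = length of the edge list).
Uniform : ℕ → Hypergraph → Set
Uniform k H = All (λ e → ∣ e ∣ ≡ k) (E H) × Unique (E H)

∣E∣ : Hypergraph → ℕ
∣E∣ H = length (E H)

image : ∀ {a b} → (Fin a → Fin b) → Subset a → Subset b
image φ s = tabulate λ x → ⌊ any? (λ y → (y ∈? s) ×-dec (φ y ≟ x)) ⌋

Colouring : Hypergraph → Set
Colouring H = Fin (∣E∣ H) → Bool

MonoCopy : (G H : Hypergraph) → Colouring H → Bool → Set
MonoCopy G H c col =
  Σ (Fin (V G) → Fin (V H)) λ φ →
    Injective _≡_ _≡_ φ ×
    All (λ e → ∃ λ (i : Fin (∣E∣ H)) → lookup (E H) i ≡ image φ e × c i ≡ col) (E G)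

_⟶_ : Hypergraph → Hypergraph → Set
H ⟶ G = (c : Colouring H) → ∃ λ col → MonoCopy G H c col

IsSizeRamsey : ℕ → Hypergraph → ℕ → Set
IsSizeRamsey k G r =
  (∃ λ H → Uniform k H × H ⟶ G × ∣E∣ H ≡ r) ×
  (∀ H → Uniform k H → H ⟶ G → r ≤ ∣E∣ H)

interval : (n a k : ℕ) → Subset n
interval n a k = tabulate λ x → ⌊ a ≤? toℕ x ⌋ ∧ ⌊ toℕ x <? a + k ⌋

-- the ℓ-path P^(k)_{n,ℓ} with m edges on vertex set Fin n (0-based):
-- e_i = {i(k-ℓ), ..., i(k-ℓ)+k-1} for i = 0..m-1, where n = ℓ + m(k-ℓ).
ℓPath : (k ℓ n m : ℕ) → Hypergraph
ℓPath k ℓ n m = hg n (map (λ i → interval n (i * (k ∸ ℓ)) k) (upTo m))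

P : ℕ → Hypergraph
P n = hg n (map (λ i → interval n i 2) (upTo (n ∸ 1)))

-- Take a graph H with H → P_n and |E(H)| = R̂(P_n) and write k = 2ℓ + d. Blow H up into a k-graph
-- with the same number of edges: each vertex x becomes ℓ copies of x, and each edge xy becomes the
-- k-set made of the copies of x, d new vertices private to xy, and the copies of y. Distinct edges
-- stay distinct, and a colouring of the blow-up is a colouring of H, so it contains a monochromatic
-- path w_0 … w_{n-1}. The blown-up edges w_i w_{i+1}, i < m, form a monochromatic ℓ-path on n
-- vertices, because consecutive ones share exactly the ℓ copies of w_{i+1}.

module Submission where

open import Defs
open import Data.Nat using (ℕ; _+_; _*_; _∸_; _≤_)
open import Relation.Binary.PropositionalEquality using (_≡_)

open import Data.Nat using (zero; suc; z≤n; s≤s; z<s; _<_; _≤?_; _<?_; NonZero; >-nonZero; >-nonZero⁻¹)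
open import Data.Bool using (Bool; true; _∧_)
open import Data.Bool.Properties using (T-≡; T-∧)
open import Data.Empty using (⊥-elim)
open import Data.Fin as Fin using (Fin; toℕ; fromℕ<; combine; remQuot; _≟_)
open import Data.Fin.Properties as Fin
  using (any?; toℕ-injective; toℕ-fromℕ<; toℕ<n; remQuot-combine; combine-remQuot)
open import Data.Fin.Subset using (Subset; ∣_∣; _∈_; _∉_; _⊆_; _-_; Nonempty; inside; outside; ⊥)
open import Data.Fin.Subset.Properties
  using (_∈?_; ∣⊥∣≡0; Empty-unique; nonempty?; ⊆-antisym; x∈p∧x≢y⇒x∈p-y; p─q⊆p; p─⊥≡p)
open import Data.Nat.Properties hiding (_≟_)
open import Data.Nat.DivMod
  using (_/_; _%_; _mod_; m≡m%n+[m/n]*n; m/n≤m; m%n<n; m<n⇒m%n≡m; m<n⇒m/n≡0; m*n/n≡m; +-distrib-/-∣ˡ; %-remove-+ˡ)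
open import Data.Nat.Divisibility using (n∣m*n)
open import Data.Nat.Tactic.RingSolver using (solve-∀)
open import Data.List as List using (List; map)
open import Data.List.Properties using (length-map)
open import Data.List.Relation.Unary.All as All using (All)
import Data.List.Relation.Unary.All.Properties as All
import Data.List.Relation.Unary.Unique.Propositional.Properties as Unique
open import Data.Product using (∃; ∃₂; _×_; _,_; proj₁; proj₂)
open import Data.Sum using (_⊎_; inj₁; inj₂)
open import Data.Vec using (_∷_; tabulate; here; there)
open import Data.Vec.Properties using (lookup∘tabulate; []=⇒lookup; lookup⇒[]=)
open import Function using (_∘_; id)
open import Function.Bundles using (Equivalence)
open import Function.Definitions using (Injective)
open import Relation.Binary.PropositionalEquality
  using (refl; sym; trans; cong; cong₂; subst; _≢_; ≢-sym; module ≡-Reasoning)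
open import Relation.Nullary using (Dec; yes; no; contradiction)
open import Relation.Nullary.Decidable using (⌊_⌋; _×-dec_; _⊎-dec_; toWitness; fromWitness)

open Equivalence using (to; from)

-- Subsets of Fin n

∈-tabulate⁺ : ∀ {n} {f : Fin n → Bool} {x} → f x ≡ true → x ∈ tabulate f
∈-tabulate⁺ {f = f} {x} fx≡true = lookup⇒[]= x (tabulate f) (trans (lookup∘tabulate f x) fx≡true)

∈-tabulate⁻ : ∀ {n} {f : Fin n → Bool} {x} → x ∈ tabulate f → f x ≡ true
∈-tabulate⁻ {f = f} {x} x∈ = trans (sym (lookup∘tabulate f x)) ([]=⇒lookup x∈)

∈-decide⁺ : ∀ {n} {P : Fin n → Set} (P? : ∀ x → Dec (P x)) {x} → P x → x ∈ tabulate (λ y → ⌊ P? y ⌋)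
∈-decide⁺ P? px = ∈-tabulate⁺ (to T-≡ (fromWitness px))

∈-decide⁻ : ∀ {n} {P : Fin n → Set} (P? : ∀ x → Dec (P x)) {x} → x ∈ tabulate (λ y → ⌊ P? y ⌋) → P x
∈-decide⁻ P? x∈ = toWitness (from T-≡ (∈-tabulate⁻ x∈))

x∉p-x : ∀ {n} (p : Subset n) x → x ∉ p - x
x∉p-x (_ ∷ p) Fin.zero    ()
x∉p-x (_ ∷ p) (Fin.suc x) (there x∈) = x∉p-x p x x∈

∣p∣≡1+∣p-x∣ : ∀ {n} {p : Subset n} {x} → x ∈ p → ∣ p ∣ ≡ suc ∣ p - x ∣
∣p∣≡1+∣p-x∣ {p = inside ∷ p}  here        = cong (suc ∘ ∣_∣) (sym (p─⊥≡p p))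
∣p∣≡1+∣p-x∣ {p = inside ∷ p}  (there x∈p) = cong suc (∣p∣≡1+∣p-x∣ x∈p)
∣p∣≡1+∣p-x∣ {p = outside ∷ p} (there x∈p) = ∣p∣≡1+∣p-x∣ x∈p

∣p∣≡1+m⇒nonempty : ∀ {n m} (p : Subset n) → ∣ p ∣ ≡ suc m → Nonempty p
∣p∣≡1+m⇒nonempty {n} p ∣p∣≡1+m with nonempty? p
... | yes ne = ne
... | no  ¬ne = contradiction (trans (sym ∣p∣≡1+m) (trans (cong ∣_∣ (Empty-unique ¬ne)) (∣⊥∣≡0 n))) λ ()

∈-remove⁻ : ∀ {n} {p : Subset n} {x y} → x ∈ p - y → x ∈ p × x ≢ y
∈-remove⁻ {p = p} {y = y} x∈p-y = p─q⊆p p _ x∈p-y , λ { refl → x∉p-x p y x∈p-y }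

injection⇒∣p∣≡ : ∀ {n m} (p : Subset n) (g : Fin m → Fin n) → Injective _≡_ _≡_ g →
                 (∀ i → g i ∈ p) → (∀ x → x ∈ p → ∃ λ i → g i ≡ x) → ∣ p ∣ ≡ m
injection⇒∣p∣≡ {n} {zero} p g _ _ onto =
  trans (cong ∣_∣ (Empty-unique λ (x , x∈p) → Fin.¬Fin0 (proj₁ (onto x x∈p)))) (∣⊥∣≡0 n)
injection⇒∣p∣≡ {m = suc m} p g g-inj g∈p onto =
  trans (∣p∣≡1+∣p-x∣ (g∈p Fin.zero))
        (cong suc (injection⇒∣p∣≡ (p - g Fin.zero) (g ∘ Fin.suc) (Fin.suc-injective ∘ g-inj) g∘suc∈ onto′))
  where
  g∘suc∈ : ∀ i → g (Fin.suc i) ∈ p - g Fin.zero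
  g∘suc∈ i = x∈p∧x≢y⇒x∈p-y (g∈p (Fin.suc i)) (λ eq → Fin.0≢1+n (g-inj (sym eq)))
  onto′ : ∀ x → x ∈ p - g Fin.zero → ∃ λ i → g (Fin.suc i) ≡ x
  onto′ x x∈ with ∈-remove⁻ x∈
  ... | x∈p , x≢g0 with onto x x∈p
  ... | Fin.zero  , refl = contradiction refl x≢g0
  ... | Fin.suc i , eq   = i , eq

record IsPairOf {n} (p : Subset n) (u v : Fin n) : Set where
  field
    distinct : u ≢ v
    left∈    : u ∈ p
    right∈   : v ∈ p
    only     : ∀ {x} → x ∈ p → x ≡ u ⊎ x ≡ v

∣p∣≡2⇒pair : ∀ {n} (p : Subset n) → ∣ p ∣ ≡ 2 → ∃₂ (IsPairOf p)
∣p∣≡2⇒pair {n} p ∣p∣≡2 = u , v , record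
  { distinct = ≢-sym (proj₂ (∈-remove⁻ v∈p-u))
  ; left∈    = u∈p
  ; right∈   = proj₁ (∈-remove⁻ v∈p-u)
  ; only     = only
  }
  where
  u : Fin n
  u = proj₁ (∣p∣≡1+m⇒nonempty p ∣p∣≡2)
  u∈p : u ∈ p
  u∈p = proj₂ (∣p∣≡1+m⇒nonempty p ∣p∣≡2)
  ∣p-u∣≡1 : ∣ p - u ∣ ≡ 1
  ∣p-u∣≡1 = suc-injective (trans (sym (∣p∣≡1+∣p-x∣ u∈p)) ∣p∣≡2)
  v : Fin n
  v = proj₁ (∣p∣≡1+m⇒nonempty (p - u) ∣p-u∣≡1)
  v∈p-u : v ∈ p - u
  v∈p-u = proj₂ (∣p∣≡1+m⇒nonempty (p - u) ∣p-u∣≡1)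
  ∣p-u-v∣≡0 : ∣ p - u - v ∣ ≡ 0
  ∣p-u-v∣≡0 = suc-injective (trans (sym (∣p∣≡1+∣p-x∣ v∈p-u)) ∣p-u∣≡1)
  only : ∀ {x} → x ∈ p → x ≡ u ⊎ x ≡ v
  only {x} x∈p with x ≟ u | x ≟ v
  ... | yes x≡u | _       = inj₁ x≡u
  ... | no _    | yes x≡v = inj₂ x≡v
  ... | no x≢u  | no x≢v  =
    ⊥-elim (0≢1+n (trans (sym ∣p-u-v∣≡0) (∣p∣≡1+∣p-x∣ (x∈p∧x≢y⇒x∈p-y (x∈p∧x≢y⇒x∈p-y x∈p x≢u) x≢v))))

∈-image⁺ : ∀ {a b} (φ : Fin a → Fin b) {s y} → y ∈ s → φ y ∈ image φ s
∈-image⁺ φ {s} y∈s = ∈-decide⁺ (λ x → any? λ y → (y ∈? s) ×-dec (φ y ≟ x)) (_ , y∈s , refl)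

∈-image⁻ : ∀ {a b} (φ : Fin a → Fin b) {s x} → x ∈ image φ s → ∃ λ y → y ∈ s × φ y ≡ x
∈-image⁻ φ {s} = ∈-decide⁻ (λ x → any? λ y → (y ∈? s) ×-dec (φ y ≟ x))

∈-interval⁺ : ∀ {n a k} {x : Fin n} → a ≤ toℕ x → toℕ x < a + k → x ∈ interval n a k
∈-interval⁺ {a = a} {k} {x} a≤x x<a+k =
  ∈-tabulate⁺ (cong₂ _∧_ (to T-≡ (fromWitness {a? = a ≤? toℕ x} a≤x))
                         (to T-≡ (fromWitness {a? = toℕ x <? a + k} x<a+k)))

∈-interval⁻ : ∀ {n a k} {x : Fin n} → x ∈ interval n a k → a ≤ toℕ x × toℕ x < a + k
∈-interval⁻ {a = a} {k} {x} x∈ with to T-∧ (from T-≡ (∈-tabulate⁻ {x = x} x∈))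
... | a≤x , x<a+k = toWitness {a? = a ≤? toℕ x} a≤x , toWitness {a? = toℕ x <? a + k} x<a+k

-- Encodings and arithmetic

module _ {V k : ℕ} where

  triple : Fin V → Fin V → Fin k → Fin (V * (V * k))
  triple x y t = combine x (combine y t)

  untriple : Fin (V * (V * k)) → Fin V × Fin V × Fin k
  untriple z = proj₁ (remQuot {V} (V * k) z) , remQuot {V} k (proj₂ (remQuot {V} (V * k) z))

  untriple-triple : ∀ (x y : Fin V) (t : Fin k) → untriple (triple x y t) ≡ (x , y , t)
  untriple-triple x y t =
    cong₂ _,_ (cong proj₁ x,yt) (trans (cong (remQuot {V} k ∘ proj₂) x,yt) (remQuot-combine y t))
    where
    x,yt : remQuot {V} (V * k) (triple x y t) ≡ (x , combine y t)
    x,yt = remQuot-combine x (combine y t)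

  triple-untriple : ∀ (z : Fin (V * (V * k))) → let (x , y , t) = untriple z in triple x y t ≡ z
  triple-untriple z =
    trans (cong (combine {V} (proj₁ (untriple z))) (combine-remQuot {V} k _)) (combine-remQuot {V} (V * k) z)

  triple-injective : ∀ {x y x′ y′ : Fin V} {t t′ : Fin k} →
                     triple x y t ≡ triple x′ y′ t′ → x ≡ x′ × y ≡ y′ × t ≡ t′
  triple-injective {x = x} {y} {x′} {y′} {t} {t′} eq
    with trans (sym (untriple-triple x y t)) (trans (cong untriple eq) (untriple-triple x′ y′ t′))
  ... | refl = refl , refl , refl

m≤j<m+n⇒j∸m<n : ∀ {m n j} → m ≤ j → j < m + n → j ∸ m < n
m≤j<m+n⇒j∸m<n {m} {n} m≤j j<m+n = +-cancelˡ-< m _ n (subst (_< m + n) (sym (m+[n∸m]≡n m≤j)) j<m+n)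

i≤a<i+2⇒a≡i⊎a≡1+i : ∀ {i a} → i ≤ a → a < i + 2 → a ≡ i ⊎ a ≡ suc i
i≤a<i+2⇒a≡i⊎a≡1+i {i} i≤a a<i+2 with m≤n⇒∃[o]m+o≡n i≤a
... | 0           , refl = inj₁ (+-identityʳ i)
... | 1           , refl = inj₂ (+-comm i 1)
... | suc (suc o) , refl = contradiction a<i+2 (≤⇒≯ (+-monoʳ-≤ i (s≤s (s≤s z≤n))))

m+n+m≡2m+n : ∀ m n → m + n + m ≡ 2 * m + n
m+n+m≡2m+n = solve-∀

lookup-map : ∀ {A B : Set} (f : A → B) (xs : List A) (i : Fin (List.length xs)) →
             List.lookup (map f xs) (Fin.cast (sym (length-map f xs)) i) ≡ f (List.lookup xs i)
lookup-map f (_ List.∷ xs) Fin.zero    = refl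
lookup-map f (_ List.∷ xs) (Fin.suc i) = lookup-map f xs i

toℕ-mod : ∀ {m n} .{{_ : NonZero n}} → m < n → toℕ (m mod n) ≡ m
toℕ-mod {m} {n} m<n = trans (toℕ-fromℕ< (m%n<n m n)) (m<n⇒m%n≡m m<n)

mod-toℕ : ∀ {n} .{{_ : NonZero n}} (i : Fin n) → toℕ i mod n ≡ i
mod-toℕ i = toℕ-injective (toℕ-mod (toℕ<n i))

mod-injective : ∀ {m m′ n} .{{_ : NonZero n}} → m < n → m′ < n → m mod n ≡ m′ mod n → m ≡ m′
mod-injective m<n m′<n eq = trans (sym (toℕ-mod m<n)) (trans (cong toℕ eq) (toℕ-mod m′<n))

[q*c+r]/c≡q : ∀ q {r c} .{{_ : NonZero c}} → r < c → (q * c + r) / c ≡ q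
[q*c+r]/c≡q q {r} {c} r<c = begin
  (q * c + r) / c     ≡⟨ +-distrib-/-∣ˡ r (n∣m*n q) ⟩
  q * c / c + r / c   ≡⟨ cong₂ _+_ (m*n/n≡m q c) (m<n⇒m/n≡0 r<c) ⟩
  q + 0               ≡⟨ +-identityʳ q ⟩
  q                   ∎
  where open ≡-Reasoning

[q*c+r]%c≡r : ∀ q {r c} .{{_ : NonZero c}} → r < c → (q * c + r) % c ≡ r
[q*c+r]%c≡r q r<c = trans (%-remove-+ˡ _ (n∣m*n q)) (m<n⇒m%n≡m r<c)

-- The blow-up of a graph

module BlowUp (ℓ d : ℕ) .{{_ : NonZero ℓ}} where

  c k : ℕ
  c = ℓ + d
  k = c + ℓ

  0<ℓ : 0 < ℓ
  0<ℓ = >-nonZero⁻¹ ℓ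

  ℓ≤k : ℓ ≤ k
  ℓ≤k = m≤n+m ℓ c

  c≤k : c ≤ k
  c≤k = m≤m+n c ℓ

  d≤k : d ≤ k
  d≤k = ≤-trans (m≤n+m d ℓ) c≤k

  instance
    c≢0 : NonZero c
    c≢0 = >-nonZero (<-≤-trans 0<ℓ (m≤m+n ℓ d))

    k≢0 : NonZero k
    k≢0 = >-nonZero (<-≤-trans 0<ℓ ℓ≤k)

  toℕ-mod-< : ∀ {j m} → m ≤ k → j < m → toℕ (j mod k) < m
  toℕ-mod-< m≤k j<m = subst (_< _) (sym (toℕ-mod (<-≤-trans j<m m≤k))) j<m

  ∸-<k : ∀ {j} m → j < k → j ∸ m < k
  ∸-<k {j} m j<k = ≤-<-trans (m∸n≤m j m) j<k

  data Segment (j : ℕ) : Set where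
    left   : j < ℓ → Segment j
    middle : ℓ ≤ j → j < c → Segment j
    right  : c ≤ j → Segment j

  segment : ∀ j → Segment j
  segment j with j <? ℓ | j <? c
  ... | yes j<ℓ | _       = left j<ℓ
  ... | no  j≮ℓ | yes j<c = middle (≮⇒≥ j≮ℓ) j<c
  ... | no  _   | no  j≮c = right (≮⇒≥ j≮c)

  module _ {V : ℕ} where

    -- A vertex of the blow-up is a triple (x, y, t): (x, x, t) with t < ℓ is the t-th copy of x, and
    -- (x, y, t) with x < y and t < d is the t-th private vertex of the edge xy. Indices are read mod k.
    vertexCopy : Fin V → ℕ → Fin (V * (V * k))
    vertexCopy x j = triple x x (j mod k)

    edgeCopy : Fin V → Fin V → ℕ → Fin (V * (V * k))
    edgeCopy x y j with toℕ x <? toℕ y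
    ... | yes _ = triple x y (j mod k)
    ... | no  _ = triple y x (j mod k)

    blowVertex : Fin V → Fin V → ℕ → Fin (V * (V * k))
    blowVertex u v j with segment j
    ... | left _     = vertexCopy u j
    ... | middle _ _ = edgeCopy u v (j ∸ ℓ)
    ... | right _    = vertexCopy v (j ∸ c)

    blowVertex-left : ∀ {u v j} → j < ℓ → blowVertex u v j ≡ vertexCopy u j
    blowVertex-left {j = j} j<ℓ with segment j
    ... | left _       = refl
    ... | middle ℓ≤j _ = contradiction j<ℓ (≤⇒≯ ℓ≤j)
    ... | right c≤j    = contradiction (<-≤-trans j<ℓ (m≤m+n ℓ d)) (≤⇒≯ c≤j)

    blowVertex-middle : ∀ {u v j} → ℓ ≤ j → j < c → blowVertex u v j ≡ edgeCopy u v (j ∸ ℓ)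
    blowVertex-middle {j = j} ℓ≤j j<c with segment j
    ... | left j<ℓ   = contradiction j<ℓ (≤⇒≯ ℓ≤j)
    ... | middle _ _ = refl
    ... | right c≤j  = contradiction j<c (≤⇒≯ c≤j)

    blowVertex-right : ∀ {u v j} → c ≤ j → blowVertex u v j ≡ vertexCopy v (j ∸ c)
    blowVertex-right {j = j} c≤j with segment j
    ... | left j<ℓ     = contradiction (<-≤-trans j<ℓ (m≤m+n ℓ d)) (≤⇒≯ c≤j)
    ... | middle _ j<c = contradiction j<c (≤⇒≯ c≤j)
    ... | right _      = refl

    vertexCopy-injective : ∀ {x y j j′} → vertexCopy x j ≡ vertexCopy y j′ → x ≡ y × j mod k ≡ j′ mod k
    vertexCopy-injective eq with triple-injective eq
    ... | x≡y , _ , t≡t′ = x≡y , t≡t′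

    edgeCopy-< : ∀ {x y} j → toℕ x < toℕ y → edgeCopy x y j ≡ triple x y (j mod k)
    edgeCopy-< {x} {y} j x<y with toℕ x <? toℕ y
    ... | yes _   = refl
    ... | no  x≮y = contradiction x<y x≮y

    edgeCopy-comm : ∀ {x y} j → x ≢ y → edgeCopy x y j ≡ edgeCopy y x j
    edgeCopy-comm {x} {y} j x≢y with toℕ x <? toℕ y | toℕ y <? toℕ x
    ... | yes x<y | yes y<x = contradiction y<x (<-asym x<y)
    ... | yes _   | no  _   = refl
    ... | no  _   | yes _   = refl
    ... | no  x≮y | no  y≮x = contradiction (toℕ-injective (≤-antisym (≮⇒≥ y≮x) (≮⇒≥ x≮y))) x≢y

    edgeCopy-injective : ∀ {x y x′ y′ j j′} → edgeCopy x y j ≡ edgeCopy x′ y′ j′ →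
                         j mod k ≡ j′ mod k × (x ≡ x′ × y ≡ y′ ⊎ x ≡ y′ × y ≡ x′)
    edgeCopy-injective {x} {y} {x′} {y′} eq with toℕ x <? toℕ y | toℕ x′ <? toℕ y′
    ... | yes _ | yes _ = let x≡x′ , y≡y′ , t≡t′ = triple-injective eq in t≡t′ , inj₁ (x≡x′ , y≡y′)
    ... | yes _ | no  _ = let x≡y′ , y≡x′ , t≡t′ = triple-injective eq in t≡t′ , inj₂ (x≡y′ , y≡x′)
    ... | no  _ | yes _ = let y≡x′ , x≡y′ , t≡t′ = triple-injective eq in t≡t′ , inj₂ (x≡y′ , y≡x′)
    ... | no  _ | no  _ = let y≡y′ , x≡x′ , t≡t′ = triple-injective eq in t≡t′ , inj₁ (x≡x′ , y≡y′)

    vertexCopy≢edgeCopy : ∀ {x y z j j′} → x ≢ y → vertexCopy z j ≢ edgeCopy x y j′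
    vertexCopy≢edgeCopy {x} {y} x≢y eq with toℕ x <? toℕ y
    ... | yes _ = let z≡x , z≡y , _ = triple-injective eq in x≢y (trans (sym z≡x) z≡y)
    ... | no  _ = let z≡y , z≡x , _ = triple-injective eq in x≢y (trans (sym z≡x) z≡y)

    InBlowUp : Subset V → Fin V × Fin V × Fin k → Set
    InBlowUp s (x , y , t) = x ≡ y × toℕ t < ℓ × x ∈ s
                           ⊎ toℕ x < toℕ y × toℕ t < d × x ∈ s × y ∈ s

    inBlowUp? : ∀ s z → Dec (InBlowUp s z)
    inBlowUp? s (x , y , t) = (x ≟ y ×-dec toℕ t <? ℓ ×-dec x ∈? s)
                          ⊎-dec (toℕ x <? toℕ y ×-dec toℕ t <? d ×-dec x ∈? s ×-dec y ∈? s)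

    blowUpEdge : Subset V → Subset (V * (V * k))
    blowUpEdge s = tabulate λ z → ⌊ inBlowUp? s (untriple z) ⌋

    ∈-blowUpEdge⁺ : ∀ {s x y t} → InBlowUp s (x , y , t) → triple x y t ∈ blowUpEdge s
    ∈-blowUpEdge⁺ {s} {x} {y} {t} h =
      ∈-decide⁺ (λ z → inBlowUp? s (untriple z)) (subst (InBlowUp s) (sym (untriple-triple x y t)) h)

    ∈-blowUpEdge⁻ : ∀ {s z} → z ∈ blowUpEdge s →
                    ∃₂ λ x y → ∃ λ t → z ≡ triple x y t × InBlowUp s (x , y , t)
    ∈-blowUpEdge⁻ {s} {z} z∈ =
      _ , _ , _ , sym (triple-untriple {V} {k} z) , ∈-decide⁻ (λ z → inBlowUp? s (untriple z)) z∈

    vertexCopy-∈-blowUpEdge : ∀ {s x j} → x ∈ s → j < ℓ → vertexCopy x j ∈ blowUpEdge s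
    vertexCopy-∈-blowUpEdge x∈s j<ℓ = ∈-blowUpEdge⁺ (inj₁ (refl , toℕ-mod-< ℓ≤k j<ℓ , x∈s))

    vertexCopy-∈-blowUpEdge⁻ : ∀ {s x j} → vertexCopy x j ∈ blowUpEdge s → x ∈ s
    vertexCopy-∈-blowUpEdge⁻ {s} x∈ with ∈-blowUpEdge⁻ x∈
    ... | _ , _ , _ , eq , inj₁ (refl , _ , x′∈s) = subst (_∈ s) (sym (proj₁ (triple-injective eq))) x′∈s
    ... | _ , _ , _ , eq , inj₂ (x′<y′ , _) =
      let x≡x′ , x≡y′ , _ = triple-injective eq
      in ⊥-elim (<-irrefl (cong toℕ (trans (sym x≡x′) x≡y′)) x′<y′)

    edgeCopy-∈-blowUpEdge : ∀ {s x y j} → x ≢ y → x ∈ s → y ∈ s → j < d → edgeCopy x y j ∈ blowUpEdge s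
    edgeCopy-∈-blowUpEdge {s} {x} {y} {j} x≢y x∈s y∈s j<d with toℕ x <? toℕ y
    ... | yes x<y = ∈-blowUpEdge⁺ (inj₂ (x<y , toℕ-mod-< d≤k j<d , x∈s , y∈s))
    ... | no  x≮y = ∈-blowUpEdge⁺ (inj₂ (y<x , toℕ-mod-< d≤k j<d , y∈s , x∈s))
      where
      y<x : toℕ y < toℕ x
      y<x = ≤∧≢⇒< (≮⇒≥ x≮y) (x≢y ∘ sym ∘ toℕ-injective)

    blowVertex-injective : ∀ {u v j j′} → u ≢ v → j < k → j′ < k →
                           blowVertex u v j ≡ blowVertex u v j′ → j ≡ j′
    blowVertex-injective {u} {v} {j} {j′} u≢v j<k j′<k eq with segment j | segment j′
    ... | left j<ℓ    | left j′<ℓ    =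
      mod-injective (<-≤-trans j<ℓ ℓ≤k) (<-≤-trans j′<ℓ ℓ≤k) (proj₂ (vertexCopy-injective eq))
    ... | left _      | middle _ _   = contradiction eq (vertexCopy≢edgeCopy u≢v)
    ... | left _      | right _      = contradiction (proj₁ (vertexCopy-injective eq)) u≢v
    ... | middle _ _  | left _       = contradiction (sym eq) (vertexCopy≢edgeCopy u≢v)
    ... | middle ℓ≤j _ | middle ℓ≤j′ _ =
      ∸-cancelʳ-≡ ℓ≤j ℓ≤j′
        (mod-injective (∸-<k ℓ j<k) (∸-<k ℓ j′<k) (proj₁ (edgeCopy-injective {u} {v} {u} {v} eq)))
    ... | middle _ _  | right _      = contradiction (sym eq) (vertexCopy≢edgeCopy u≢v)
    ... | right _     | left _       = contradiction (sym (proj₁ (vertexCopy-injective eq))) u≢v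
    ... | right _     | middle _ _   = contradiction eq (vertexCopy≢edgeCopy u≢v)
    ... | right c≤j   | right c≤j′   =
      ∸-cancelʳ-≡ c≤j c≤j′
        (mod-injective (∸-<k c j<k) (∸-<k c j′<k) (proj₂ (vertexCopy-injective {v} {v} eq)))

    module _ {s : Subset V} {u v : Fin V} (uv : IsPairOf s u v) where
      open IsPairOf uv

      blowVertex-∈-blowUpEdge : ∀ {j} → j < k → blowVertex u v j ∈ blowUpEdge s
      blowVertex-∈-blowUpEdge {j} j<k with segment j
      ... | left j<ℓ       = vertexCopy-∈-blowUpEdge left∈ j<ℓ
      ... | middle ℓ≤j j<c = edgeCopy-∈-blowUpEdge distinct left∈ right∈ (m≤j<m+n⇒j∸m<n ℓ≤j j<c)
      ... | right c≤j      = vertexCopy-∈-blowUpEdge right∈ (m≤j<m+n⇒j∸m<n c≤j j<k)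

      edgeCopy-pair : ∀ {x y} j → x ≢ y → x ∈ s → y ∈ s → edgeCopy u v j ≡ edgeCopy x y j
      edgeCopy-pair j x≢y x∈s y∈s with only x∈s | only y∈s
      ... | inj₁ refl | inj₁ refl = contradiction refl x≢y
      ... | inj₁ refl | inj₂ refl = refl
      ... | inj₂ refl | inj₁ refl = edgeCopy-comm j distinct
      ... | inj₂ refl | inj₂ refl = contradiction refl x≢y

      blowUpEdge⊆blowVertex : ∀ {z} → z ∈ blowUpEdge s → ∃ λ j → j < k × blowVertex u v j ≡ z
      blowUpEdge⊆blowVertex z∈ with ∈-blowUpEdge⁻ z∈
      ... | x , y , t , refl , inj₂ (x<y , t<d , x∈s , y∈s) =
        ℓ + toℕ t , <-≤-trans (+-monoʳ-< ℓ t<d) c≤k , (begin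
          blowVertex u v (ℓ + toℕ t)    ≡⟨ blowVertex-middle (m≤m+n ℓ _) (+-monoʳ-< ℓ t<d) ⟩
          edgeCopy u v (ℓ + toℕ t ∸ ℓ)  ≡⟨ cong (edgeCopy u v) (m+n∸m≡n ℓ _) ⟩
          edgeCopy u v (toℕ t)          ≡⟨ edgeCopy-pair (toℕ t) (λ { refl → <-irrefl refl x<y }) x∈s y∈s ⟩
          edgeCopy x y (toℕ t)          ≡⟨ edgeCopy-< (toℕ t) x<y ⟩
          triple x y (toℕ t mod k)      ≡⟨ cong (triple x y) (mod-toℕ t) ⟩
          triple x y t                  ∎)
        where open ≡-Reasoning
      ... | x , _ , t , refl , inj₁ (refl , t<ℓ , x∈s) with only x∈s
      ...   | inj₁ refl = toℕ t , <-≤-trans t<ℓ ℓ≤k ,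
                          trans (blowVertex-left t<ℓ) (cong (triple u u) (mod-toℕ t))
      ...   | inj₂ refl = c + toℕ t , +-monoʳ-< c t<ℓ ,
                          trans (blowVertex-right (m≤m+n c _))
                                (cong (triple v v) (trans (cong (_mod k) (m+n∸m≡n c _)) (mod-toℕ t)))

    ∣blowUpEdge∣ : ∀ {s : Subset V} → ∣ s ∣ ≡ 2 → ∣ blowUpEdge s ∣ ≡ k
    ∣blowUpEdge∣ {s} ∣s∣≡2 with ∣p∣≡2⇒pair s ∣s∣≡2
    ... | u , v , uv = injection⇒∣p∣≡ (blowUpEdge s) (blowVertex u v ∘ toℕ)
      (toℕ-injective ∘ blowVertex-injective (IsPairOf.distinct uv) (toℕ<n _) (toℕ<n _))
      (λ i → blowVertex-∈-blowUpEdge uv (toℕ<n i))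
      (λ _ z∈ → let j , j<k , eq = blowUpEdge⊆blowVertex uv z∈ in
                fromℕ< j<k , trans (cong (blowVertex u v) (toℕ-fromℕ< j<k)) eq)

    blowUpEdge-injective : Injective _≡_ _≡_ blowUpEdge
    blowUpEdge-injective eq = ⊆-antisym (⊆-from eq) (⊆-from (sym eq))
      where
      ⊆-from : ∀ {s s′} → blowUpEdge s ≡ blowUpEdge s′ → s ⊆ s′
      ⊆-from eq x∈s =
        vertexCopy-∈-blowUpEdge⁻ (subst (vertexCopy _ 0 ∈_) eq (vertexCopy-∈-blowUpEdge x∈s 0<ℓ))

  blowUp : Hypergraph → Hypergraph
  blowUp H = hg (V H * (V H * k)) (map blowUpEdge (E H))

  blowUp-uniform : ∀ {H} → Uniform 2 H → Uniform k (blowUp H)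
  blowUp-uniform (sizes , unique) =
    All.map⁺ (All.map (λ {s} → ∣blowUpEdge∣ {s = s}) sizes) , Unique.map⁺ blowUpEdge-injective unique

  -- A monochromatic path in H yields a monochromatic ℓ-path in its blow-up

  module PathCopy {m n : ℕ} (n≡ : n ≡ ℓ + m * c)
                  {V : ℕ} (φ : Fin n → Fin V) (φ-injective : Injective _≡_ _≡_ φ) where

    m<n : m < n
    m<n = subst (m <_) (sym n≡) (≤-<-trans (m≤m*n m c) (m<n+m (m * c) 0<ℓ))

    instance
      n≢0 : NonZero n
      n≢0 = >-nonZero (≤-<-trans z≤n m<n)

    -- The vertices w_q of the path; q mod n is junk for q ≥ n.
    w : ℕ → Fin V
    w q = φ (q mod n)

    w-injective : ∀ {q q′} → q < n → q′ < n → w q ≡ w q′ → q ≡ q′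
    w-injective q<n q′<n = mod-injective q<n q′<n ∘ φ-injective

    w-distinct : ∀ {q} → suc q < n → w q ≢ w (suc q)
    w-distinct 1+q<n = 1+n≢n ∘ sym ∘ w-injective (<-trans (n<1+n _) 1+q<n) 1+q<n

    pathEdge-pair : ∀ {i} → suc i < n → IsPairOf (image φ (interval n i 2)) (w i) (w (suc i))
    pathEdge-pair {i} 1+i<n = record
      { distinct = w-distinct 1+i<n
      ; left∈    = ∈-image⁺ φ (∈-interval⁺ (≤-reflexive (sym i≡)) (subst (_< i + 2) (sym i≡) (m<m+n i z<s)))
      ; right∈   = ∈-image⁺ φ (∈-interval⁺ (subst (i ≤_) (sym 1+i≡) (n≤1+n i))
                                            (subst (_< i + 2) (sym 1+i≡) (subst (suc i <_) (+-comm 2 i) (n<1+n _))))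
      ; only     = only
      }
      where
      i≡ : toℕ (i mod n) ≡ i
      i≡ = toℕ-mod (<-trans (n<1+n i) 1+i<n)
      1+i≡ : toℕ (suc i mod n) ≡ suc i
      1+i≡ = toℕ-mod 1+i<n
      only : ∀ {x} → x ∈ image φ (interval n i 2) → x ≡ w i ⊎ x ≡ w (suc i)
      only x∈ with ∈-image⁻ φ x∈
      ... | y , y∈ , refl with ∈-interval⁻ y∈
      ... | i≤y , y<i+2 with i≤a<i+2⇒a≡i⊎a≡1+i i≤y y<i+2
      ... | inj₁ y≡i   = inj₁ (cong φ (toℕ-injective (trans y≡i (sym i≡))))
      ... | inj₂ y≡1+i = inj₂ (cong φ (toℕ-injective (trans y≡1+i (sym 1+i≡))))

    quotient offset : Fin n → ℕ
    quotient p = toℕ p / c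
    offset p = toℕ p % c

    -- The vertex q c + r (r < c) of the ℓ-path goes to position r of the blown-up edge w_q w_{q+1}.
    -- The last ℓ positions of an ℓ-path edge are the first ℓ of the next one; both readings give
    -- copies of the shared path vertex, which is what embed-local records.
    embed : Fin n → Fin (V * (V * k))
    embed p = blowVertex (w (quotient p)) (w (suc (quotient p))) (offset p)

    embed-coordinates : ∀ {p q r} → toℕ p ≡ q * c + r → r < c → embed p ≡ blowVertex (w q) (w (suc q)) r
    embed-coordinates {p} {q} {r} p≡ r<c = trans
      (cong (λ x → blowVertex (w (x / c)) (w (suc (x / c))) (x % c)) p≡)
      (cong₂ (λ q r → blowVertex (w q) (w (suc q)) r) ([q*c+r]/c≡q q r<c) ([q*c+r]%c≡r q r<c))

    embed-local : ∀ {p i j} → toℕ p ≡ i * c + j → j < k → embed p ≡ blowVertex (w i) (w (suc i)) j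
    embed-local {p} {i} {j} p≡ j<k with c ≤? j
    ... | no  c≰j = embed-coordinates p≡ (≰⇒> c≰j)
    ... | yes c≤j with m≤n⇒∃[o]m+o≡n c≤j
    ... | t , refl = begin
      embed p                                     ≡⟨ embed-coordinates p≡′ (<-≤-trans t<ℓ (m≤m+n ℓ d)) ⟩
      blowVertex (w (suc i)) (w (suc (suc i))) t  ≡⟨ blowVertex-left t<ℓ ⟩
      vertexCopy (w (suc i)) t                    ≡⟨ cong (vertexCopy (w (suc i))) (m+n∸m≡n c t) ⟨
      vertexCopy (w (suc i)) (c + t ∸ c)          ≡⟨ blowVertex-right (m≤m+n c t) ⟨
      blowVertex (w i) (w (suc i)) (c + t)        ∎
      where
      open ≡-Reasoning
      t<ℓ : t < ℓ
      t<ℓ = +-cancelˡ-< c t ℓ j<k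
      p≡′ : toℕ p ≡ suc i * c + t
      p≡′ = trans p≡ (trans (sym (+-assoc (i * c) c t)) (cong (_+ t) (+-comm (i * c) c)))

    quotient<n : ∀ p → quotient p < n
    quotient<n p = ≤-<-trans (m/n≤m (toℕ p) c) (toℕ<n p)

    offset<k : ∀ p → offset p < k
    offset<k p = <-≤-trans (m%n<n (toℕ p) c) c≤k

    1+quotient<n : ∀ p → ℓ ≤ offset p → suc (quotient p) < n
    1+quotient<n p ℓ≤r = ≤-<-trans quotient<m m<n
      where
      open ≤-Reasoning
      quotient<m : quotient p < m
      quotient<m = *-cancelʳ-< c (quotient p) m (+-cancelˡ-< ℓ _ _ (begin-strict
        ℓ + quotient p * c         ≤⟨ +-monoˡ-≤ _ ℓ≤r ⟩
        offset p + quotient p * c  ≡⟨ m≡m%n+[m/n]*n (toℕ p) c ⟨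
        toℕ p                      <⟨ toℕ<n p ⟩
        n                          ≡⟨ n≡ ⟩
        ℓ + m * c                  ∎))

    embed-middle : ∀ p → ℓ ≤ offset p →
                   embed p ≡ edgeCopy (w (quotient p)) (w (suc (quotient p))) (offset p ∸ ℓ)
    embed-middle p ℓ≤r = blowVertex-middle ℓ≤r (m%n<n (toℕ p) c)

    consecutive-injective : ∀ {q q′} → suc q < n → suc q′ < n →
                            w q ≡ w q′ × w (suc q) ≡ w (suc q′) ⊎ w q ≡ w (suc q′) × w (suc q) ≡ w q′ → q ≡ q′
    consecutive-injective 1+q<n 1+q′<n (inj₁ (wq≡wq′ , _)) =
      w-injective (<-trans (n<1+n _) 1+q<n) (<-trans (n<1+n _) 1+q′<n) wq≡wq′
    consecutive-injective 1+q<n 1+q′<n (inj₂ (wq≡w1+q′ , w1+q≡wq′)) = ⊥-elim (<-asym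
      (≤-reflexive (sym (w-injective (<-trans (n<1+n _) 1+q<n) 1+q′<n wq≡w1+q′)))
      (≤-reflexive (w-injective 1+q<n (<-trans (n<1+n _) 1+q′<n) w1+q≡wq′)))

    embed-coordinates-injective : ∀ {p p′} → embed p ≡ embed p′ →
                                  quotient p ≡ quotient p′ × offset p ≡ offset p′
    embed-coordinates-injective {p} {p′} eq with ℓ ≤? offset p | ℓ ≤? offset p′
    ... | no ℓ≰r | no ℓ≰r′ =
      let r<ℓ = ≰⇒> ℓ≰r ; r′<ℓ = ≰⇒> ℓ≰r′
          wq≡wq′ , r≡r′ =
            vertexCopy-injective (trans (sym (blowVertex-left r<ℓ)) (trans eq (blowVertex-left r′<ℓ)))
      in w-injective (quotient<n p) (quotient<n p′) wq≡wq′ ,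
         mod-injective (<-≤-trans r<ℓ ℓ≤k) (<-≤-trans r′<ℓ ℓ≤k) r≡r′
    ... | no ℓ≰r | yes ℓ≤r′ = contradiction
      (trans (sym (blowVertex-left (≰⇒> ℓ≰r))) (trans eq (embed-middle p′ ℓ≤r′)))
      (vertexCopy≢edgeCopy (w-distinct (1+quotient<n p′ ℓ≤r′)))
    ... | yes ℓ≤r | no ℓ≰r′ = contradiction
      (trans (sym (blowVertex-left (≰⇒> ℓ≰r′))) (trans (sym eq) (embed-middle p ℓ≤r)))
      (vertexCopy≢edgeCopy (w-distinct (1+quotient<n p ℓ≤r)))
    ... | yes ℓ≤r | yes ℓ≤r′ =
      let t≡t′ , ends =
            edgeCopy-injective (trans (sym (embed-middle p ℓ≤r)) (trans eq (embed-middle p′ ℓ≤r′)))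
      in consecutive-injective (1+quotient<n p ℓ≤r) (1+quotient<n p′ ℓ≤r′) ends ,
         ∸-cancelʳ-≡ ℓ≤r ℓ≤r′ (mod-injective (∸-<k ℓ (offset<k p)) (∸-<k ℓ (offset<k p′)) t≡t′)

    embed-injective : Injective _≡_ _≡_ embed
    embed-injective {p} {p′} eq with embed-coordinates-injective eq
    ... | q≡q′ , r≡r′ = toℕ-injective (begin
      toℕ p                        ≡⟨ m≡m%n+[m/n]*n (toℕ p) c ⟩
      offset p + quotient p * c    ≡⟨ cong₂ (λ r q → r + q * c) r≡r′ q≡q′ ⟩
      offset p′ + quotient p′ * c  ≡⟨ m≡m%n+[m/n]*n (toℕ p′) c ⟨
      toℕ p′                       ∎)
      where open ≡-Reasoning

    embed-edge : ∀ {i s} → i < m → IsPairOf s (w i) (w (suc i)) →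
                 image embed (interval n (i * c) k) ≡ blowUpEdge s
    embed-edge {i} {s} i<m uv = ⊆-antisym image⊆blowUpEdge blowUpEdge⊆image
      where
      image⊆blowUpEdge : image embed (interval n (i * c) k) ⊆ blowUpEdge s
      image⊆blowUpEdge z∈ with ∈-image⁻ embed z∈
      ... | p , p∈ , refl with ∈-interval⁻ p∈
      ... | ic≤p , p<ic+k with m≤n⇒∃[o]m+o≡n ic≤p
      ... | j , ic+j≡p =
        subst (_∈ blowUpEdge s) (sym (embed-local (sym ic+j≡p) j<k)) (blowVertex-∈-blowUpEdge uv j<k)
        where j<k = +-cancelˡ-< (i * c) j k (subst (_< i * c + k) (sym ic+j≡p) p<ic+k)

      blowUpEdge⊆image : blowUpEdge s ⊆ image embed (interval n (i * c) k)
      blowUpEdge⊆image z∈ with blowUpEdge⊆blowVertex uv z∈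
      ... | j , j<k , refl =
        subst (_∈ image embed (interval n (i * c) k)) (embed-local p≡ j<k) (∈-image⁺ embed p∈)
        where
        open ≤-Reasoning
        ic+j<n : i * c + j < n
        ic+j<n = begin-strict
          i * c + j        <⟨ +-monoʳ-< (i * c) j<k ⟩
          i * c + (c + ℓ)  ≡⟨ +-assoc (i * c) c ℓ ⟨
          i * c + c + ℓ    ≡⟨ cong (_+ ℓ) (+-comm (i * c) c) ⟩
          suc i * c + ℓ    ≤⟨ +-monoˡ-≤ ℓ (*-monoˡ-≤ c i<m) ⟩
          m * c + ℓ        ≡⟨ +-comm (m * c) ℓ ⟩
          ℓ + m * c        ≡⟨ n≡ ⟨
          n                ∎
        p≡ : toℕ ((i * c + j) mod n) ≡ i * c + j
        p≡ = toℕ-mod ic+j<n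
        p∈ : (i * c + j) mod n ∈ interval n (i * c) k
        p∈ = ∈-interval⁺ (subst (i * c ≤_) (sym p≡) (m≤m+n _ _))
                         (subst (_< i * c + k) (sym p≡) (+-monoʳ-< _ j<k))

  k∸ℓ≡c : k ∸ ℓ ≡ c
  k∸ℓ≡c = m+n∸n≡m c ℓ

  blowUp-⟶ : ∀ {m n H} → n ≡ ℓ + m * c → H ⟶ P n → blowUp H ⟶ ℓPath k ℓ n m
  blowUp-⟶ {m} {n} {H} n≡ H⟶Pn colour with H⟶Pn (colour ∘ Fin.cast (sym (length-map blowUpEdge (E H))))
  ... | col , φ , φ-injective , pathEdges =
    col , embed , embed-injective , All.map⁺ (All.applyUpTo⁺₁ id m copy)
    where
    open PathCopy {m} n≡ φ φ-injective
    copy : ∀ {i} → i < m →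
           ∃ λ e → List.lookup (E (blowUp H)) e ≡ image embed (interval n (i * (k ∸ ℓ)) k) × colour e ≡ col
    copy {i} i<m with All.applyUpTo⁻ id (n ∸ 1) (All.map⁻ pathEdges) (<-≤-trans i<m (<⇒≤pred m<n))
    ... | e , Eₑ≡ , colourₑ = Fin.cast (sym (length-map blowUpEdge (E H))) e , (begin
      List.lookup (map blowUpEdge (E H)) (Fin.cast _ e)  ≡⟨ lookup-map blowUpEdge (E H) e ⟩
      blowUpEdge (List.lookup (E H) e)                  ≡⟨ cong blowUpEdge Eₑ≡ ⟩
      blowUpEdge (image φ (interval n i 2))             ≡⟨ embed-edge i<m (pathEdge-pair (≤-<-trans i<m m<n)) ⟨
      image embed (interval n (i * c) k)                ≡⟨ cong (λ x → image embed (interval n (i * x) k)) k∸ℓ≡c ⟨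
      image embed (interval n (i * (k ∸ ℓ)) k)          ∎) , colourₑ
      where open ≡-Reasoning

  ℓPath-sizeRamsey≤ : ∀ {m n a b} → n ≡ ℓ + m * (k ∸ ℓ) →
                      IsSizeRamsey k (ℓPath k ℓ n m) a → IsSizeRamsey 2 (P n) b → a ≤ b
  ℓPath-sizeRamsey≤ {m} {n} {a} {b} n≡ (_ , minimal) ((H , H-uniform , H⟶Pn , ∣E∣≡b) , _) = begin
    a               ≤⟨ minimal (blowUp H) (blowUp-uniform {H} H-uniform) (blowUp-⟶ {H = H} n≡′ H⟶Pn) ⟩
    ∣E∣ (blowUp H)  ≡⟨ length-map blowUpEdge (E H) ⟩
    ∣E∣ H           ≡⟨ ∣E∣≡b ⟩
    b               ∎
    where
    open ≤-Reasoning
    n≡′ : n ≡ ℓ + m * c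
    n≡′ = trans n≡ (cong (λ x → ℓ + m * x) k∸ℓ≡c)

proposition1 : (k ℓ n m : ℕ) → 2 ≤ k → 1 ≤ ℓ → 2 * ℓ ≤ k →
    n ≡ ℓ + m * (k ∸ ℓ) →
    (a b : ℕ) → IsSizeRamsey k (ℓPath k ℓ n m) a → IsSizeRamsey 2 (P n) b → a ≤ b
-- The hypothesis 2 ≤ k follows from 1 ≤ ℓ and 2ℓ ≤ k.
proposition1 k ℓ n m _ 1≤ℓ 2ℓ≤k n≡ a b with m≤n⇒∃[o]m+o≡n 2ℓ≤k
... | d , 2ℓ+d≡k with trans (m+n+m≡2m+n ℓ d) 2ℓ+d≡k
... | refl = BlowUp.ℓPath-sizeRamsey≤ ℓ d {{>-nonZero 1≤ℓ}} n≡
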